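{- Let $(\sigma,\eta):\mathcal{A}\to\mathcal{A}'$ be an open morphism of asynchronous systems. Then for each reachable state $s\in S$ and each $n\ge 0$, the map $Q_n(\mathcal{A}(s))\to Q_n(\mathcal{A}'(\sigma(s)))$, $(t,e_1,\dots,e_n)\mapsto(\sigma(t),\eta(e_1),\dots,\eta(e_n))$, is surjective.
   Context: A state space $(S,E,I,\mathrm{Tran})$: states $S$, events $E$, symmetric irreflexive independence $I\subseteq E\times E$, transitions $\mathrm{Tran}\subseteq S\times E\times S$, with (1) $(s,a,s'),(s,a,s'')\in\mathrm{Tran}\Rightarrow s'=s''$; (2) if $(a,b)\in I$, $(s,a,s'),(s',b,s'')\in\mathrm{Tran}$ then some $s_1$ has $(s,b,s_1),(s_1,a,s'')\in\mathrm{Tran}$. An asynchronous system $\mathcal{A}=(S,s_0,E,I,\mathrm{Tran})$ adds an initial state $s_0$, every event occurring in some transition. For a word $w=e_1\cdots e_k$, $s\cdot w\in S$ means there are $s=t_0,\dots,t_k$ with $(t_{i-1},e_i,t_i)\in\mathrm{Tran}$, and $s\cdot w=t_k$. A state is reachable if it is $s_0\cdot w$ for some word $w$ (possibly empty). For reachable $s$, $\mathcal{A}(s)=(S,s,E,I,\mathrm{Tran})$ (initial state changed to $s$). For an asynchronous system $\mathcal{B}$ with initial state $b_0$, $Q_0(\mathcal{B})$ is its set of states reachable from $b_0$, and for $n>0$, $Q_n(\mathcal{B})$ is the set of tuples $(t,e_1,\dots,e_n)$ with $t$ reachable, $t\cdot e_1\cdots e_n$ defined, and $(e_i,e_j)$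 independent for all $i<j$. A morphism $(\sigma,\eta):\mathcal{A}\to\mathcal{A}'=(S',s'_0,E',I',\mathrm{Tran}')$: total $\sigma:S\to S'$ with $\sigma(s_0)=s'_0$, partial $\eta:E\rightharpoonup E'$, such that for each $(s_1,e,s_2)\in\mathrm{Tran}$, $(\sigma(s_1),\eta(e),\sigma(s_2))\in\mathrm{Tran}'$ if $\eta(e)$ is defined and $\sigma(s_1)=\sigma(s_2)$ otherwise, and $(\eta(e_1),\eta(e_2))\in I'$ for $(e_1,e_2)\in I$ with both defined. It is open if (a) $\eta$ is total; (b) for every $s\in S$ and $(\sigma(s),e',u')\in\mathrm{Tran}'$ there is $(s,e,u)\in\mathrm{Tran}$ with $\eta(e)=e'$, $\sigma(u)=u'$; (c) for every reachable $s$, if $(s,e_1,u),(u,e_2,v)\in\mathrm{Tran}$ and $(\eta(e_1),\eta(e_2))\in I'$ then $(e_1,e_2)\in I$. -}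

module Defs where

open import Data.Nat using (ℕ; _<_)
open import Data.Fin using (Fin; toℕ)
open import Data.Vec using (Vec; []; _∷_; lookup; map)
open import Data.List using (List; []; _∷_)
open import Data.Maybe using (Maybe; just; nothing)
open import Data.Product using (Σ; ∃; ∃-syntax; _×_; _,_)
open import Relation.Nullary using (¬_)
open import Relation.Binary.PropositionalEquality using (_≡_)

record StateSpace : Set₁ where
  field
    S      : Set
    E      : Set
    I      : E → E → Set
    Tran   : S → E → S → Set
    I-sym     : ∀ {a b} → I a b → I b a
    I-irrefl  : ∀ {a} → ¬ I a a
    determ : ∀ {s a s′ s″} → Tran s a s′ → Tran s a s″ → s′ ≡ s″
    diamond : ∀ {a b s s′ s″} → I a b → Tran s a s′ → Tran s′ b s″ →
              ∃[ s₁ ] (Tran s b s₁ × Tran s₁ a s″)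

record AsyncSystem : Set₁ where
  field
    space : StateSpace
  open StateSpace space public
  field
    s₀ : S
    eventOccurs : ∀ (e : E) → ∃[ s ] ∃[ s′ ] Tran s e s′

module _ (A : AsyncSystem) where
  open AsyncSystem A

  -- Run s w t : s · w is defined and equals t
  data Run : S → List E → S → Set where
    nil  : ∀ {s} → Run s [] s
    cons : ∀ {s e u w t} → Tran s e u → Run u w t → Run s (e ∷ w) t

  Defined : S → List E → Set
  Defined s w = ∃[ t ] Run s w t

  -- t is reachable from s (i.e. reachable in A(s), the system with initial state s)
  ReachableFrom : S → S → Set
  ReachableFrom s t = ∃[ w ] Run s w t

  Reachable : S → Set
  Reachable = ReachableFrom s₀

  -- Q_n(A(s)) for n > 0 ; for n = 0 this is (t, []) ≅ states reachable from s,
  -- which matches Q_0(A(s)) (conditions on events are vacuous).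
  Q : ℕ → S → Set
  Q n s = Σ S λ t → Σ (Vec E n) λ es →
            ReachableFrom s t ×
            Defined t (Data.Vec.toList es) ×
            (∀ (i j : Fin n) → toℕ i < toℕ j → I (lookup es i) (lookup es j))

record Morphism (A A′ : AsyncSystem) : Set where
  private
    module A  = AsyncSystem A
    module A′ = AsyncSystem A′
  field
    σ : A.S → A′.S
    η : A.E → Maybe A′.E
    σ-init : σ A.s₀ ≡ A′.s₀
    tran-def   : ∀ {s₁ e s₂ e′} → A.Tran s₁ e s₂ → η e ≡ just e′ → A′.Tran (σ s₁) e′ (σ s₂)
    tran-undef : ∀ {s₁ e s₂} → A.Tran s₁ e s₂ → η e ≡ nothing → σ s₁ ≡ σ s₂
    indep : ∀ {e₁ e₂ e₁′ e₂′} → A.I e₁ e₂ → η e₁ ≡ just e₁′ → η e₂ ≡ just e₂′ → A′.I e₁′ e₂′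

module _ {A A′ : AsyncSystem} (f : Morphism A A′) where
  private
    module A  = AsyncSystem A
    module A′ = AsyncSystem A′
  open Morphism f

  record IsOpen : Set where
    field
      total : ∀ (e : A.E) → ∃[ e′ ] η e ≡ just e′
      lift  : ∀ (s : A.S) {e′ u′} → A′.Tran (σ s) e′ u′ →
              ∃[ e ] ∃[ u ] (A.Tran s e u × η e ≡ just e′ × σ u ≡ u′)
      reflectI : ∀ {s e₁ u e₂ v e₁′ e₂′} → Reachable A s →
                 A.Tran s e₁ u → A.Tran u e₂ v →
                 η e₁ ≡ just e₁′ → η e₂ ≡ just e₂′ → A′.I e₁′ e₂′ → A.I e₁ e₂

-- Both halves of a point of Q_n(A′(σ s)) are lifted along σ by condition (b):
-- the run from σ s to t′ and the run of e₁′ ⋯ eₙ′ from t′. Independence of the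
-- lifted events comes from condition (c): eᵢ is compared with eᵢ₊₁ by (c), and
-- the diamond property then moves eᵢ past eᵢ₊₁ to a new reachable state, where
-- it can be compared with eᵢ₊₂, and so on.
module Submission where

open import Defs
open import Data.Nat using (ℕ; _<_; s≤s; z≤n)
open import Data.Fin using (zero; suc; toℕ)
open import Data.Vec using (Vec; []; _∷_; map; lookup; toList)
open import Data.Vec.Properties using (∷-injective)
open import Data.List using (List; []; _∷_; _++_)
open import Data.Maybe using (just)
open import Data.Product using (Σ; _×_; _,_; proj₁; proj₂)
open import Relation.Binary.PropositionalEquality using (_≡_; refl; cong₂)

module _ {A : AsyncSystem} where
  open AsyncSystem A

  Run-++ : ∀ {s w t v u} → Run A s w t → Run A t v u → Run A s (w ++ v) u
  Run-++ nil        r′ = r′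
  Run-++ (cons t r) r′ = cons t (Run-++ r r′)

  ReachableFrom-trans : ∀ {s t u} → ReachableFrom A s t → ReachableFrom A t u →
                        ReachableFrom A s u
  ReachableFrom-trans (w , r) (v , r′) = w ++ v , Run-++ r r′

  Reachable-step : ∀ {s e u} → Reachable A s → Tran s e u → Reachable A u
  Reachable-step rs t = ReachableFrom-trans rs (_ , cons t nil)

module _ {A A′ : AsyncSystem} {f : Morphism A A′} (open-f : IsOpen f) where
  private
    module A  = AsyncSystem A
    module A′ = AsyncSystem A′
  open Morphism f
  open IsOpen open-f

  lift-run : ∀ {s w′ t′} → Run A′ (σ s) w′ t′ →
             Σ (List A.E) λ w → Σ A.S λ t → Run A s w t × σ t ≡ t′
  lift-run nil = [] , _ , nil , refl
  lift-run {s} (cons t′ r′) with lift s t′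
  ... | e , u , t , _ , refl with lift-run r′
  ...   | w , v , r , σv = e ∷ w , v , cons t r , σv

  lift-ReachableFrom : ∀ {s t′} → ReachableFrom A′ (σ s) t′ →
                       Σ A.S λ t → ReachableFrom A s t × σ t ≡ t′
  lift-ReachableFrom (_ , r′) with lift-run r′
  ... | w , t , r , σt = t , (w , r) , σt

  lift-runVec : ∀ {n s t′} (es′ : Vec A′.E n) → Run A′ (σ s) (toList es′) t′ →
                Σ (Vec A.E n) λ es → Σ A.S λ t →
                  Run A s (toList es) t × σ t ≡ t′ × map η es ≡ map just es′
  lift-runVec [] nil = [] , _ , nil , refl , refl
  lift-runVec {s = s} (_ ∷ es′) (cons t′ r′) with lift s t′
  ... | e , u , t , ηe , refl with lift-runVec es′ r′
  ...   | es , v , r , σv , ηes = e ∷ es , v , cons t r , σv , cong₂ _∷_ ηe ηes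

  reflect-independent-of-run :
    ∀ {n s e u v e′} (ws : Vec A.E n) (ws′ : Vec A′.E n) →
    Reachable A s → A.Tran s e u → Run A u (toList ws) v →
    η e ≡ just e′ → map η ws ≡ map just ws′ →
    (∀ k → A′.I e′ (lookup ws′ k)) → ∀ k → A.I e (lookup ws k)
  reflect-independent-of-run (a ∷ ws) (a′ ∷ ws′) rs t (cons ta r) ηe ηws h k
    with ∷-injective ηws
  ... | ηa , ηws′ with reflectI rs t ta ηe ηa (h zero) | k
  ...   | Iea | zero  = Iea
  ...   | Iea | suc k with A.diamond Iea t ta
  ...     | _ , ta′ , t′ =
    reflect-independent-of-run ws ws′ (Reachable-step rs ta′) t′ r ηe ηws′ (λ k → h (suc k)) k

  reflect-pairwise-independent :
    ∀ {n s v} (es : Vec A.E n) (es′ : Vec A′.E n) →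
    Reachable A s → Run A s (toList es) v → map η es ≡ map just es′ →
    (∀ i j → toℕ i < toℕ j → A′.I (lookup es′ i) (lookup es′ j)) →
    ∀ i j → toℕ i < toℕ j → A.I (lookup es i) (lookup es j)
  reflect-pairwise-independent (_ ∷ es) (_ ∷ es′) rs (cons t r) ηes h zero (suc j) _ =
    reflect-independent-of-run es es′ rs t r (proj₁ (∷-injective ηes))
      (proj₂ (∷-injective ηes)) (λ k → h zero (suc k) (s≤s z≤n)) j
  reflect-pairwise-independent (_ ∷ es) (_ ∷ es′) rs (cons t r) ηes h (suc i) (suc j) (s≤s i<j) =
    reflect-pairwise-independent es es′ (Reachable-step rs t) r (proj₂ (∷-injective ηes))
      (λ a b a<b → h (suc a) (suc b) (s≤s a<b)) i j i<j

mainTheorem5 : (A A′ : AsyncSystem) (f : Morphism A A′) → IsOpen f →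
    ∀ (s : AsyncSystem.S A) → Reachable A s → ∀ (n : ℕ) →
    ∀ (q′ : Q A′ n (Morphism.σ f s)) →
      Σ (Q A n s) λ q →
        (Morphism.σ f (proj₁ q) ≡ proj₁ q′) ×
        (map (Morphism.η f) (proj₁ (proj₂ q)) ≡ map just (proj₁ (proj₂ q′)))
mainTheorem5 A A′ f open-f s rs n (t′ , es′ , s⇝t′ , (_ , r′) , indep′)
  with lift-ReachableFrom open-f s⇝t′
... | t , s⇝t , refl with lift-runVec open-f es′ r′
...   | es , v , r , _ , ηes =
  (t , es , s⇝t , (v , r) ,
   reflect-pairwise-independent open-f es es′ (ReachableFrom-trans rs s⇝t) r ηes indep′)
  , refl , ηes
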